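{- Let $G$ and $H$ be connected graphs with $|V(G)|,|V(H)|\ge 2$, and let $c$ be an exact $r$-coloring of $G\square H$ with $r\ge 3$ such that no 3-AP is rainbow under $c$. Then $|c(V(G_i))|\le 2$ for every $1\le i\le |V(H)|$.
   Context: All graphs are finite, simple and undirected; $\textup{d}(u,v)$ denotes shortest-path distance. The Cartesian product $G\square H$ has vertex set $V(G)\times V(H)$, with $(x,y)$ adjacent to $(x',y')$ iff either $x=x'$ and $yy'\in E(H)$, or $y=y'$ and $xx'\in E(G)$. Write $V(G)=\{u_1,\dots,u_{n_1}\}$, $V(H)=\{w_1,\dots,w_{n_2}\}$ and $v_{a,b}=(u_a,w_b)$. For $1\le i\le n_2$, $G_i$ is the copy of $G$ corresponding to $w_i$, the subgraph induced by $\{v_{1,i},\dots,v_{n_1,i}\}$. A 3-term arithmetic progression (3-AP) is a set of vertices $\{v_1,v_2,v_3\}$ (listed in some order) with $\textup{d}(v_1,v_2)=\textup{d}(v_2,v_3)$. An exact $r$-coloring is a surjective map $c:V\to\{1,\dots,r\}$; a set is rainbow under $c$ if its vertices receive pairwise distinct colors; $c(S)=\{c(s):s\in S\}$. -}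

module Defs where

open import Data.Nat using (ℕ; zero; suc; _≤_)
open import Data.Fin using (Fin)
open import Data.Fin.Properties using (_≟_)
open import Data.Fin.Subset using (Subset)
open import Data.Fin.Properties using (any?)
open import Data.Vec using (tabulate)
open import Data.Product using (_×_; _,_; ∃; Σ)
open import Relation.Nullary using (¬_; does)
open import Relation.Binary.PropositionalEquality using (_≡_; _≢_)

record Graph : Set₁ where
  field
    n     : ℕ
    Adj   : Fin n → Fin n → Set
    sym   : ∀ {u v} → Adj u v → Adj v u
    irrefl : ∀ {u} → ¬ Adj u u
open Graph public

data Walk {V : Set} (E : V → V → Set) : V → V → ℕ → Set where
  here : ∀ {u} → Walk E u u zero
  step : ∀ {u w v k} → E u w → Walk E w v k → Walk E u v (suc k)

Dist : {V : Set} → (V → V → Set) → V → V → ℕ → Set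
Dist E u v k = Walk E u v k × (∀ m → Walk E u v m → k ≤ m)

Connected : Graph → Set
Connected G = ∀ (u v : Fin (n G)) → ∃ λ k → Walk (Adj G) u v k

□V : Graph → Graph → Set
□V G H = Fin (n G) × Fin (n H)

□Adj : (G H : Graph) → □V G H → □V G H → Set
□Adj G H (x , y) (x' , y') = (x ≡ x' × Adj H y y') Data.Sum.⊎ (y ≡ y' × Adj G x x')
  where import Data.Sum

ExactColoring : (G H : Graph) (r : ℕ) → (□V G H → Fin r) → Set
ExactColoring G H r c = ∀ (j : Fin r) → ∃ λ v → c v ≡ j

Rainbow3AP : (G H : Graph) (r : ℕ) → (□V G H → Fin r) → Set
Rainbow3AP G H r c =
  Σ (□V G H) λ v₁ → Σ (□V G H) λ v₂ → Σ (□V G H) λ v₃ → Σ ℕ λ k →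
    Dist (□Adj G H) v₁ v₂ k × Dist (□Adj G H) v₂ v₃ k ×
    c v₁ ≢ c v₂ × c v₂ ≢ c v₃ × c v₁ ≢ c v₃

colorsOfCopy : (G H : Graph) (r : ℕ) → (□V G H → Fin r) → Fin (n H) → Subset r
colorsOfCopy G H r c i = tabulate λ j → does (any? λ a → c (a , i) ≟ j)

-- Call a geodesic in a copy of G tricolored if its two ends and some interior vertex get three
-- distinct colours. There is none, by induction on the length: in a shortest one all interior
-- vertices share a colour, so for even length the midpoint and the two ends form a rainbow 3-AP,
-- and odd length is excluded by looking at a neighbouring copy of G. Now if an edge xy of a copy
-- has two colours, every vertex z of the copy has one of them: either z is equidistant from x and
-- y, and x, z, y is a 3-AP, or a geodesic from z to the nearer end extends through the edge.
-- Following a path between two differently coloured vertices yields such an edge.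

module Submission where

open import Defs hiding (sym)
open import Data.Nat using (ℕ; zero; suc; _+_; _∸_; _≤_; _<_; z≤n; s≤s; _≤?_)
open import Data.Nat.Properties hiding (_≟_; suc-injective)
open import Data.Nat.Induction using (<-rec)
open import Data.Fin using (Fin; punchIn) renaming (zero to fzero; suc to fsuc)
open import Data.Fin.Properties using (_≟_; any?; punchInᵢ≢i; suc-injective)
open import Data.Fin.Subset using (Subset; _∈_; ∣_∣; Nonempty)
open import Data.Bool using (true; false)
open import Data.Vec.Base using (_∷_)
import Data.Vec.Base as Vec
open import Data.Vec.Properties using ([]=⇒lookup; lookup∘tabulate)
open import Data.Product using (∃; ∃₂; _×_; _,_; proj₁; proj₂)
import Data.Product as Product
open import Data.Sum using (_⊎_; inj₁; inj₂)
open import Data.Empty using (⊥; ⊥-elim)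
open import Function using (_∘_)
open import Relation.Nullary using (¬_; yes; no)
open import Relation.Nullary.Decidable using (decidable-stable; proof)
open import Relation.Nullary.Reflects using (Reflects; invert)
open import Relation.Binary.Definitions using (Symmetric; DecidableEquality; Tri; tri<; tri≈; tri>)
open import Relation.Binary.PropositionalEquality
  using (_≡_; _≢_; refl; sym; trans; cong; subst; subst₂; ≢-sym)

Distinct₃ : {A : Set} → A → A → A → Set
Distinct₃ x y z = x ≢ y × y ≢ z × x ≢ z

Distinct₃-resp : ∀ {A : Set} {x y z x' y' z' : A} →
                 x ≡ x' → y ≡ y' → z ≡ z' → Distinct₃ x' y' z' → Distinct₃ x y z
Distinct₃-resp refl refl refl d = d

¬Distinct₃-of-two : ∀ {A : Set} {x y z X Y : A} →
                    x ≡ X ⊎ x ≡ Y → y ≡ X ⊎ y ≡ Y → z ≡ X ⊎ z ≡ Y → ¬ Distinct₃ x y z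
¬Distinct₃-of-two (inj₁ refl) (inj₁ refl) _           (x≢y , _ , _)   = x≢y refl
¬Distinct₃-of-two (inj₂ refl) (inj₂ refl) _           (x≢y , _ , _)   = x≢y refl
¬Distinct₃-of-two (inj₁ refl) (inj₂ refl) (inj₁ refl) (_ , _ , x≢z)   = x≢z refl
¬Distinct₃-of-two (inj₁ refl) (inj₂ refl) (inj₂ refl) (_ , y≢z , _)   = y≢z refl
¬Distinct₃-of-two (inj₂ refl) (inj₁ refl) (inj₁ refl) (_ , y≢z , _)   = y≢z refl
¬Distinct₃-of-two (inj₂ refl) (inj₁ refl) (inj₂ refl) (_ , _ , x≢z)   = x≢z refl

module _ {A : Set} (_≟ᴬ_ : DecidableEquality A) where

  ¬Distinct₃⇒≡⊎≡ : ∀ {x y z : A} → x ≢ y → ¬ Distinct₃ x y z → z ≡ x ⊎ z ≡ y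
  ¬Distinct₃⇒≡⊎≡ {x} {y} {z} x≢y ¬xyz with z ≟ᴬ x | z ≟ᴬ y
  ... | yes z≡x | _       = inj₁ z≡x
  ... | no _    | yes z≡y = inj₂ z≡y
  ... | no z≢x  | no z≢y  = ⊥-elim (¬xyz (x≢y , ≢-sym z≢y , ≢-sym z≢x))

nonempty : ∀ {k} {p : Subset k} → 1 ≤ ∣ p ∣ → Nonempty p
nonempty {p = true  ∷ p} _     = fzero , Vec.here
nonempty {p = false ∷ p} 1≤|p| = Product.map fsuc Vec.there (nonempty 1≤|p|)

two-members : ∀ {k} {p : Subset k} → 2 ≤ ∣ p ∣ → ∃₂ λ x y → (x ∈ p × y ∈ p) × x ≢ y
two-members {p = true ∷ p} (s≤s 1≤|p|) with nonempty 1≤|p|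
... | y , y∈p = fzero , fsuc y , (Vec.here , Vec.there y∈p) , λ ()
two-members {p = false ∷ p} 2≤|p| with two-members 2≤|p|
... | x , y , (x∈p , y∈p) , x≢y =
  fsuc x , fsuc y , (Vec.there x∈p , Vec.there y∈p) , x≢y ∘ suc-injective

three-members : ∀ {k} {p : Subset k} → 3 ≤ ∣ p ∣ →
                ∃₂ λ x y → ∃ λ z → (x ∈ p × y ∈ p × z ∈ p) × Distinct₃ x y z
three-members {p = true ∷ p} (s≤s 2≤|p|) with two-members 2≤|p|
... | y , z , (y∈p , z∈p) , y≢z =
  fzero , fsuc y , fsuc z , (Vec.here , Vec.there y∈p , Vec.there z∈p) ,
  (λ ()) , y≢z ∘ suc-injective , (λ ())
three-members {p = false ∷ p} 3≤|p| with three-members 3≤|p|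
... | x , y , z , (x∈p , y∈p , z∈p) , (x≢y , y≢z , x≢z) =
  fsuc x , fsuc y , fsuc z , (Vec.there x∈p , Vec.there y∈p , Vec.there z∈p) ,
  x≢y ∘ suc-injective , y≢z ∘ suc-injective , x≢z ∘ suc-injective

module _ {V : Set} {E : V → V → Set} where

  private variable
    u v w : V
    k l : ℕ

  infixr 5 _++ʷ_
  _++ʷ_ : Walk E u v k → Walk E v w l → Walk E u w (k + l)
  here     ++ʷ q = q
  step e p ++ʷ q = step e (p ++ʷ q)

  infixl 5 _∷ʳ_
  _∷ʳ_ : Walk E u v k → E v w → Walk E u w (suc k)
  here     ∷ʳ e = step e here
  step e p ∷ʳ f = step e (p ∷ʳ f)

  reverse : Symmetric E → Walk E u v k → Walk E v u k
  reverse sym-E here       = here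
  reverse sym-E (step e p) = reverse sym-E p ∷ʳ sym-E e

  Dist-refl : Dist E u u 0
  Dist-refl = here , λ _ _ → z≤n

  Dist-sym : Symmetric E → Dist E u v k → Dist E v u k
  Dist-sym sym-E (p , minimal) = reverse sym-E p , λ m q → minimal m (reverse sym-E q)

  walk₀⇒≡ : Walk E u v 0 → u ≡ v
  walk₀⇒≡ here = refl

  walk⇒edge : u ≢ v → Walk E u v k → ∃ (E u)
  walk⇒edge u≢v here       = ⊥-elim (u≢v refl)
  walk⇒edge u≢v (step e _) = _ , e

  ¬¬-Dist : Walk E u v k → ¬ ¬ ∃ (Dist E u v)
  ¬¬-Dist {u} {v} {k} = <-rec (λ k → Walk E u v k → ¬ ¬ ∃ (Dist E u v)) shortest k
    where
    shortest : ∀ k → (∀ {j} → j < k → Walk E u v j → ¬ ¬ ∃ (Dist E u v)) →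
               Walk E u v k → ¬ ¬ ∃ (Dist E u v)
    shortest k shorter p ¬dist = ¬dist (k , p , minimal)
      where
      minimal : ∀ m → Walk E u v m → k ≤ m
      minimal m q with k ≤? m
      ... | yes k≤m = k≤m
      ... | no k≰m  = ⊥-elim (shorter (≰⇒> k≰m) q ¬dist)

  bichromatic-edge : ∀ {A : Set} → DecidableEquality A → (f : V → A) →
                     Walk E u v k → f u ≢ f v → ∃₂ λ x y → E x y × f x ≢ f y
  bichromatic-edge _≟ᴬ_ f here fu≢fv = ⊥-elim (fu≢fv refl)
  bichromatic-edge {u} _≟ᴬ_ f (step {w = w} e p) fu≢fv with f u ≟ᴬ f w
  ... | yes fu≡fw = bichromatic-edge _≟ᴬ_ f p (fu≢fv ∘ trans fu≡fw)
  ... | no fu≢fw  = u , w , e , fu≢fw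

  vertexAt : Walk E u v k → ℕ → V
  vertexAt {u} here       _       = u
  vertexAt {u} (step _ _) zero    = u
  vertexAt     (step _ p) (suc t) = vertexAt p t

  vertexAt-start : (p : Walk E u v k) → vertexAt p 0 ≡ u
  vertexAt-start here       = refl
  vertexAt-start (step _ _) = refl

  vertexAt-end : (p : Walk E u v k) → vertexAt p k ≡ v
  vertexAt-end here       = refl
  vertexAt-end (step _ p) = vertexAt-end p

  vertexAt-∷ʳ : (p : Walk E u v k) (e : E v w) → vertexAt (p ∷ʳ e) k ≡ v
  vertexAt-∷ʳ here       e = refl
  vertexAt-∷ʳ (step _ p) e = vertexAt-∷ʳ p e

  vertexAt-adjacent : (p : Walk E u v k) → ∀ t → t < k → E (vertexAt p t) (vertexAt p (suc t))
  vertexAt-adjacent (step e p) zero    _         = subst (E _) (sym (vertexAt-start p)) e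
  vertexAt-adjacent (step e p) (suc t) (s≤s t<k) = vertexAt-adjacent p t t<k

record Geodesic {V : Set} (E : V → V → Set) (m : ℕ) : Set where
  field
    vertex     : ℕ → V
    adjacent   : ∀ t → t < m → E (vertex t) (vertex (suc t))
    isShortest : Dist E (vertex 0) (vertex m) m

module _ {V : Set} {E : V → V → Set} where

  geodesic : ∀ {u v k} → Dist E u v k → Geodesic E k
  geodesic (p , minimal) = record
    { vertex     = vertexAt p
    ; adjacent   = vertexAt-adjacent p
    ; isShortest = subst₂ (λ x y → Dist E x y _) (sym (vertexAt-start p)) (sym (vertexAt-end p))
                          (p , minimal)
    }

  module GeodesicSegments {m : ℕ} (g : Geodesic E m) where
    open Geodesic g

    segment-walk : ∀ a d → d + a ≤ m → Walk E (vertex a) (vertex (d + a)) d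
    segment-walk a zero    _       = here
    segment-walk a (suc d) d+a<m = segment-walk a d (<⇒≤ d+a<m) ∷ʳ adjacent (d + a) d+a<m

    -- A shorter detour between vertex a and vertex b would shorten the whole geodesic.
    segment-Dist : ∀ a b d → d + a ≡ b → b ≤ m → Dist E (vertex a) (vertex b) d
    segment-Dist a .(d + a) d refl d+a≤m = segment-walk a d d+a≤m , minimal
      where
      e : ℕ
      e = m ∸ (d + a)

      d+a+e≡m : d + a + e ≡ m
      d+a+e≡m = m+[n∸m]≡n d+a≤m

      prefix : Walk E (vertex 0) (vertex a) a
      prefix = subst (λ b → Walk E (vertex 0) (vertex b) a) (+-identityʳ a)
                     (segment-walk 0 a (≤-trans (≤-reflexive (+-identityʳ a))
                                                (≤-trans (m≤n+m a d) d+a≤m)))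

      suffix : Walk E (vertex (d + a)) (vertex m) e
      suffix = subst (λ b → Walk E (vertex (d + a)) (vertex b) e) (m∸n+n≡m d+a≤m)
                     (segment-walk (d + a) e (≤-reflexive (m∸n+n≡m d+a≤m)))

      minimal : ∀ L → Walk E (vertex a) (vertex (d + a)) L → d ≤ L
      minimal L q = +-cancelʳ-≤ e d L (+-cancelˡ-≤ a (d + e) (L + e) (begin
        a + (d + e) ≡⟨ sym (+-assoc a d e) ⟩
        a + d + e   ≡⟨ cong (_+ e) (+-comm a d) ⟩
        d + a + e   ≡⟨ d+a+e≡m ⟩
        m           ≤⟨ proj₂ isShortest _ (prefix ++ʷ q ++ʷ suffix) ⟩
        a + (L + e) ∎))
        where open ≤-Reasoning

    segment : ∀ a d → d + a ≤ m → Geodesic E d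
    segment a d d+a≤m = record
      { vertex     = λ t → vertex (t + a)
      ; adjacent   = λ t t<d → adjacent (t + a) (≤-trans (+-monoˡ-≤ a t<d) d+a≤m)
      ; isShortest = segment-Dist a (d + a) d refl d+a≤m
      }

module _ (G : Graph) where

  edge-Dist : ∀ {u v} → Adj G u v → Dist (Adj G) u v 1
  edge-Dist {u} {v} e = step e here , minimal
    where
    minimal : ∀ m → Walk (Adj G) u v m → 1 ≤ m
    minimal zero    p = ⊥-elim (irrefl G (subst (Adj G u) (sym (walk₀⇒≡ p)) e))
    minimal (suc m) p = s≤s z≤n

  another-vertex : 2 ≤ n G → (u : Fin (n G)) → ∃ λ v → u ≢ v
  another-vertex (s≤s (s≤s _)) u = punchIn u fzero , ≢-sym (punchInᵢ≢i u fzero)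

  neighbour : Connected G → 2 ≤ n G → (u : Fin (n G)) → ∃ (Adj G u)
  neighbour connected 2≤n u with another-vertex 2≤n u
  ... | v , u≢v = walk⇒edge u≢v (proj₂ (connected u v))

module CartesianProduct (G H : Graph) where

  private variable
    x x' : Fin (n G)
    y y' : Fin (n H)
    d : ℕ

  liftˡ : Walk (Adj G) x x' d → Walk (□Adj G H) (x , y) (x' , y) d
  liftˡ here       = here
  liftˡ (step e p) = step (inj₂ (refl , e)) (liftˡ p)

  liftʳ : Walk (Adj H) y y' d → Walk (□Adj G H) (x , y) (x , y') d
  liftʳ here       = here
  liftʳ (step e p) = step (inj₁ (refl , e)) (liftʳ p)

  project : Walk (□Adj G H) (x , y) (x' , y') d →
            ∃₂ λ a b → a + b ≡ d × Walk (Adj G) x x' a × Walk (Adj H) y y' b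
  project here = 0 , 0 , refl , here , here
  project (step (inj₁ (refl , e)) p) with project p
  ... | a , b , a+b≡d , p₁ , p₂ =
    a , suc b , trans (+-suc a b) (cong suc a+b≡d) , p₁ , step e p₂
  project (step (inj₂ (refl , e)) p) with project p
  ... | a , b , a+b≡d , p₁ , p₂ = suc a , b , cong suc a+b≡d , step e p₁ , p₂

  □-Dist : ∀ {x x' y y' a b} → Dist (Adj G) x x' a → Dist (Adj H) y y' b →
           Dist (□Adj G H) (x , y) (x' , y') (a + b)
  □-Dist {x} {x'} {y} {y'} {a} {b} (p₁ , minimal₁) (p₂ , minimal₂) =
    liftˡ p₁ ++ʷ liftʳ p₂ , minimal
    where
    minimal : ∀ d → Walk (□Adj G H) (x , y) (x' , y') d → a + b ≤ d
    minimal d p with project p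
    ... | a' , b' , refl , q₁ , q₂ = +-mono-≤ (minimal₁ a' q₁) (minimal₂ b' q₂)

  Dist-in-copy : Dist (Adj G) x x' d → Dist (□Adj G H) (x , y) (x' , y) d
  Dist-in-copy dist = subst (Dist (□Adj G H) _ _) (+-identityʳ _) (□-Dist dist Dist-refl)

  Dist-across : Adj H y y' → Dist (Adj G) x x' d → Dist (□Adj G H) (x , y) (x' , y') (suc d)
  Dist-across e dist = subst (Dist (□Adj G H) _ _) (+-comm _ 1) (□-Dist dist (edge-Dist H e))

data Parity : ℕ → Set where
  even : ∀ h → Parity (h + h)
  odd  : ∀ h → Parity (suc (h + h))

parity : ∀ m → Parity m
parity zero = even 0
parity (suc m) with parity m
... | even h = odd h
... | odd h  = subst Parity (cong suc (+-suc h h)) (even (suc h))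

module RainbowFree (G H : Graph) (connected-H : Connected H) (2≤|H| : 2 ≤ n H)
                   {r : ℕ} (c : □V G H → Fin r) (rainbow-free : ¬ Rainbow3AP G H r c) where

  open CartesianProduct G H using (Dist-in-copy; Dist-across)

  κ : Fin (n H) → Fin (n G) → Fin r
  κ i x = c (x , i)

  3AP-not-rainbow : ∀ {v₁ v₂ v₃ k} → Dist (□Adj G H) v₁ v₂ k → Dist (□Adj G H) v₂ v₃ k →
                    ¬ Distinct₃ (c v₁) (c v₂) (c v₃)
  3AP-not-rainbow d₁₂ d₂₃ (c₁≢c₂ , c₂≢c₃ , c₁≢c₃) =
    rainbow-free (_ , _ , _ , _ , d₁₂ , d₂₃ , c₁≢c₂ , c₂≢c₃ , c₁≢c₃)

  record TricoloredGeodesic (m : ℕ) : Set where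
    field
      copy       : Fin (n H)
      path       : Geodesic (Adj G) m
      t          : ℕ
      0<t        : 0 < t
      t<m        : t < m
      tricolored : Distinct₃ (κ copy (Geodesic.vertex path 0))
                             (κ copy (Geodesic.vertex path t))
                             (κ copy (Geodesic.vertex path m))

  NoShorterTricolored : ℕ → Set
  NoShorterTricolored m = ∀ {m'} → m' < m → ¬ TricoloredGeodesic m'

  no-tricolored-subpath : ∀ {m} → NoShorterTricolored m → ∀ l (g : Geodesic (Adj G) m) {a t b} →
                          a < t → t < b → b ≤ m → 0 < a ⊎ b < m →
                          let open Geodesic g in
                          ¬ Distinct₃ (κ l (vertex a)) (κ l (vertex t)) (κ l (vertex b))
  no-tricolored-subpath {m} shorter l g {a} {t} {b} a<t t<b b≤m proper tricolored =
    shorter (b∸a<m proper) record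
      { copy       = l
      ; path       = segment a (b ∸ a) (≤-trans (≤-reflexive b∸a+a≡b) b≤m)
      ; t          = t ∸ a
      ; 0<t        = m<n⇒0<n∸m a<t
      ; t<m        = ∸-monoˡ-< t<b (<⇒≤ a<t)
      ; tricolored = Distinct₃-resp refl (cong (κ l ∘ vertex) (m∸n+n≡m (<⇒≤ a<t)))
                                         (cong (κ l ∘ vertex) b∸a+a≡b) tricolored
      }
    where
    open Geodesic g
    open GeodesicSegments g

    b∸a+a≡b : b ∸ a + a ≡ b
    b∸a+a≡b = m∸n+n≡m (≤-trans (<⇒≤ a<t) (<⇒≤ t<b))

    b∸a<m : 0 < a ⊎ b < m → b ∸ a < m
    b∸a<m (inj₁ 0<a) = ≤-trans (∸-monoʳ-< 0<a (≤-trans (<⇒≤ a<t) (<⇒≤ t<b))) b≤m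
    b∸a<m (inj₂ b<m) = ≤-<-trans (m∸n≤m b a) b<m

  module Interior {m} (shorter : NoShorterTricolored m) (tg : TricoloredGeodesic m) where
    open TricoloredGeodesic tg public
    open Geodesic path public
    open GeodesicSegments path public

    K : ℕ → Fin r
    K x = κ copy (vertex x)

    A B C : Fin r
    A = K 0
    B = K t
    C = K m

    A≢B : A ≢ B
    A≢B = proj₁ tricolored

    B≢C : B ≢ C
    B≢C = proj₁ (proj₂ tricolored)

    A≢C : A ≢ C
    A≢C = proj₂ (proj₂ tricolored)

    -- A second interior colour would split off a shorter tricolored subpath ending at 0 or m.
    interior-colour : ∀ k → 0 < k → k < m → K k ≡ B
    interior-colour k 0<k k<m = decidable-stable (K k ≟ B) λ Kk≢B → split Kk≢B (<-cmp k t)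
      where
      subpath : ∀ {a s b} → a < s → s < b → b ≤ m → 0 < a ⊎ b < m →
                ¬ Distinct₃ (K a) (K s) (K b)
      subpath = no-tricolored-subpath shorter copy path

      split : K k ≢ B → Tri (k < t) (k ≡ t) (t < k) → ⊥
      split Kk≢B (tri≈ _ k≡t _) = Kk≢B (cong K k≡t)
      split Kk≢B (tri< k<t _ _) with K k ≟ A
      ... | yes Kk≡A = subpath k<t t<m ≤-refl (inj₁ 0<k)
                                 (Distinct₃-resp Kk≡A refl refl tricolored)
      ... | no Kk≢A  = subpath 0<k k<t (<⇒≤ t<m) (inj₂ t<m) (≢-sym Kk≢A , Kk≢B , A≢B)
      split Kk≢B (tri> _ _ t<k) with K k ≟ C
      ... | yes Kk≡C = subpath 0<t t<k (<⇒≤ k<m) (inj₂ k<m)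
                                 (Distinct₃-resp refl refl Kk≡C tricolored)
      ... | no Kk≢C  = subpath t<k k<m ≤-refl (inj₁ 0<t) (≢-sym Kk≢B , Kk≢C , B≢C)

  even-length : ∀ h → NoShorterTricolored (suc h + suc h) →
                ¬ TricoloredGeodesic (suc h + suc h)
  even-length h shorter tg =
    3AP-not-rainbow (Dist-in-copy (segment-Dist 0 M M (+-identityʳ M) (<⇒≤ M<m)))
                    (Dist-in-copy (segment-Dist M m M refl ≤-refl))
                    (Distinct₃-resp refl (interior-colour M (s≤s z≤n) M<m) refl tricolored)
    where
    open Interior shorter tg
    m M : ℕ
    m = suc h + suc h
    M = suc h

    M<m : M < m
    M<m = s≤s (m≤n+m (suc h) h)

  -- In a neighbouring copy j, 3-APs through both copies force the colours B, A and C at positions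
  -- 0, 1 and 2h of the path; position 2 then has no colour left.
  odd-length : ∀ h' → NoShorterTricolored (suc (suc h' + suc h')) →
               ¬ TricoloredGeodesic (suc (suc h' + suc h'))
  odd-length h' shorter tg =
    3AP-not-rainbow (Dist-in-copy (segment-Dist 0 1 1 refl 1≤m))
                    (Dist-in-copy (segment-Dist 1 2 1 refl 2≤m))
                    (Distinct₃-resp q₀≡B q₁≡A refl (≢-sym A≢B , ≢-sym q₂≢A , ≢-sym q₂≢B))
    where
    open Interior shorter tg
    h 2h m : ℕ
    h  = suc h'
    2h = h + h
    m  = suc 2h

    j : Fin (n H)
    j = proj₁ (neighbour H connected-H 2≤|H| copy)

    l~j : Adj H copy j
    l~j = proj₂ (neighbour H connected-H 2≤|H| copy)

    j~l : Adj H j copy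
    j~l = Graph.sym H l~j

    q : ℕ → Fin r
    q x = κ j (vertex x)

    segment-Dist⁻¹ : ∀ a b d → d + a ≡ b → b ≤ m → Dist (Adj G) (vertex b) (vertex a) d
    segment-Dist⁻¹ a b d d+a≡b b≤m = Dist-sym (Graph.sym G) (segment-Dist a b d d+a≡b b≤m)

    1≤m : 1 ≤ m
    1≤m = s≤s z≤n

    2≤2h : 2 ≤ 2h
    2≤2h = s≤s (≤-trans (s≤s z≤n) (m≤n+m (suc h') h'))

    2≤m : 2 ≤ m
    2≤m = ≤-trans 2≤2h (n≤1+n 2h)

    h<m : h < m
    h<m = s≤s (m≤m+n h h)

    1+h<m : suc h < m
    1+h<m = s≤s (s≤s (m≤n+m (suc h') h'))

    B₁ : K 1 ≡ B
    B₁ = interior-colour 1 (s≤s z≤n) 2≤m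

    q₀≢A : q 0 ≢ A
    q₀≢A q₀≡A =
      3AP-not-rainbow (Dist-across j~l (segment-Dist 0 h h (+-identityʳ h) (<⇒≤ h<m)))
                      (Dist-in-copy (segment-Dist h m (suc h) refl ≤-refl))
                      (Distinct₃-resp q₀≡A (interior-colour h (s≤s z≤n) h<m) refl tricolored)

    q₀≡B : q 0 ≡ B
    q₀≡B = decidable-stable (q 0 ≟ B) λ q₀≢B →
      3AP-not-rainbow (Dist-across j~l (segment-Dist 0 0 0 refl z≤n))
                      (Dist-in-copy (segment-Dist 0 1 1 refl 1≤m))
                      (Distinct₃-resp refl refl B₁ (q₀≢A , A≢B , q₀≢B))

    q₁≢C : q 1 ≢ C
    q₁≢C q₁≡C =
      3AP-not-rainbow (Dist-in-copy (segment-Dist 0 1 1 refl 1≤m))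
                      (Dist-across l~j (segment-Dist 1 1 0 refl 1≤m))
                      (Distinct₃-resp refl B₁ q₁≡C tricolored)

    q₁≡A : q 1 ≡ A
    q₁≡A = decidable-stable (q 1 ≟ A) λ q₁≢A →
      3AP-not-rainbow (Dist-in-copy (segment-Dist 0 m m (+-identityʳ m) ≤-refl))
                      (Dist-across l~j (segment-Dist⁻¹ 1 m 2h (+-comm 2h 1) ≤-refl))
                      (A≢C , ≢-sym q₁≢C , ≢-sym q₁≢A)

    q₂ₕ≢A : q 2h ≢ A
    q₂ₕ≢A q₂ₕ≡A =
      3AP-not-rainbow (Dist-across j~l (segment-Dist 2h 2h 0 refl (n≤1+n 2h)))
                      (Dist-in-copy (segment-Dist 2h m 1 refl ≤-refl))
                      (Distinct₃-resp q₂ₕ≡A (interior-colour 2h (≤-trans (n≤1+n 1) 2≤2h) ≤-refl) refl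
                                      tricolored)

    q₂ₕ≡C : q 2h ≡ C
    q₂ₕ≡C = decidable-stable (q 2h ≟ C) λ q₂ₕ≢C →
      3AP-not-rainbow (Dist-across j~l (segment-Dist⁻¹ 0 2h 2h (+-identityʳ 2h) (n≤1+n 2h)))
                      (Dist-in-copy (segment-Dist 0 m m (+-identityʳ m) ≤-refl))
                      (q₂ₕ≢A , A≢C , q₂ₕ≢C)

    q₂≢B : q 2 ≢ B
    q₂≢B q₂≡B with m≤n⇒m<n∨m≡n 2≤2h
    ... | inj₁ 2<2h = no-tricolored-subpath shorter j path (s≤s (s≤s z≤n)) 2<2h (n≤1+n 2h)
                                            (inj₁ (s≤s z≤n)) (Distinct₃-resp q₁≡A q₂≡B q₂ₕ≡C tricolored)
    ... | inj₂ 2≡2h = B≢C (trans (sym q₂≡B) (trans (cong q 2≡2h) q₂ₕ≡C))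

    q₂≢A : q 2 ≢ A
    q₂≢A q₂≡A =
      3AP-not-rainbow (Dist-across j~l (segment-Dist 2 (suc h) h' (+-comm h' 2) (<⇒≤ 1+h<m)))
                      (Dist-in-copy (segment-Dist (suc h) m h (+-suc h h) ≤-refl))
                      (Distinct₃-resp q₂≡A (interior-colour (suc h) (s≤s z≤n) 1+h<m) refl tricolored)

  no-tricolored-geodesic : ∀ m → ¬ TricoloredGeodesic m
  no-tricolored-geodesic = <-rec (λ m → ¬ TricoloredGeodesic m) induction-step
    where
    open TricoloredGeodesic using (0<t; t<m)

    induction-step : ∀ m → NoShorterTricolored m → ¬ TricoloredGeodesic m
    induction-step m shorter tg with parity m
    induction-step .(zero + zero)           shorter tg | even zero    = <⇒≱ (t<m tg) z≤n
    induction-step .(suc h + suc h)         shorter tg | even (suc h) = even-length h shorter tg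
    induction-step .(suc (zero + zero))     shorter tg | odd zero     = <⇒≱ (t<m tg) (0<t tg)
    induction-step .(suc (suc h' + suc h')) shorter tg | odd (suc h') = odd-length h' shorter tg

  extended-geodesic-not-tricolored : ∀ i {z x y a} → Dist (Adj G) z x a → Adj G x y →
                                     Dist (Adj G) z y (suc a) → ¬ Distinct₃ (κ i z) (κ i x) (κ i y)
  extended-geodesic-not-tricolored i {a = a} (p , _) x~y (_ , minimal) zxy@(z≢x , _ , _) =
    no-tricolored-geodesic (suc a) record
      { copy       = i
      ; path       = geodesic (p ∷ʳ x~y , minimal)
      ; t          = a
      ; 0<t        = n≢0⇒n>0 λ { refl → z≢x (cong (κ i) (walk₀⇒≡ p)) }
      ; t<m        = ≤-refl
      ; tricolored = Distinct₃-resp (cong (κ i) (vertexAt-start (p ∷ʳ x~y)))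
                                    (cong (κ i) (vertexAt-∷ʳ p x~y))
                                    (cong (κ i) (vertexAt-end (p ∷ʳ x~y))) zxy
      }

  module _ (connected-G : Connected G) where

    edge-vertex-not-tricolored : ∀ i {x y z} → Adj G x y → ¬ Distinct₃ (κ i x) (κ i y) (κ i z)
    edge-vertex-not-tricolored i {x} {y} {z} x~y (x≢y , y≢z , x≢z) =
      ¬¬-Dist (proj₂ (connected-G z x)) λ (a , z⇝x) →
      ¬¬-Dist (proj₂ (connected-G z y)) λ (b , z⇝y) →
      compare z⇝x z⇝y (proj₂ z⇝y (suc a) (proj₁ z⇝x ∷ʳ x~y))
                      (proj₂ z⇝x (suc b) (proj₁ z⇝y ∷ʳ Graph.sym G x~y)) (<-cmp a b)
      where
      compare : ∀ {a b} → Dist (Adj G) z x a → Dist (Adj G) z y b → b ≤ suc a → a ≤ suc b →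
                Tri (a < b) (a ≡ b) (b < a) → ⊥
      compare z⇝x z⇝y _ _ (tri≈ _ refl _) =
        3AP-not-rainbow (Dist-in-copy (Dist-sym (Graph.sym G) z⇝x)) (Dist-in-copy z⇝y)
                        (x≢z , ≢-sym y≢z , x≢y)
      compare z⇝x z⇝y b≤1+a _ (tri< a<b _ _) =
        extended-geodesic-not-tricolored i z⇝x x~y
                                         (subst (Dist (Adj G) z y) (≤-antisym b≤1+a a<b) z⇝y)
                                         (≢-sym x≢z , x≢y , ≢-sym y≢z)
      compare z⇝x z⇝y _ a≤1+b (tri> _ _ b<a) =
        extended-geodesic-not-tricolored i z⇝y (Graph.sym G x~y)
                                         (subst (Dist (Adj G) z x) (≤-antisym a≤1+b b<a) z⇝x)
                                         (≢-sym y≢z , ≢-sym x≢y , ≢-sym x≢z)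

    copy-not-tricolored : ∀ i {a₁ a₂ a₃} → ¬ Distinct₃ (κ i a₁) (κ i a₂) (κ i a₃)
    copy-not-tricolored i {a₁} {a₂} {a₃} tricolored@(a₁≢a₂ , _)
      with bichromatic-edge _≟_ (κ i) (proj₂ (connected-G a₁ a₂)) a₁≢a₂
    ... | x , y , x~y , x≢y =
      ¬Distinct₃-of-two (on-edge a₁) (on-edge a₂) (on-edge a₃) tricolored
      where
      on-edge : ∀ z → κ i z ≡ κ i x ⊎ κ i z ≡ κ i y
      on-edge z = ¬Distinct₃⇒≡⊎≡ _≟_ x≢y (edge-vertex-not-tricolored i x~y)

∈-colorsOfCopy : ∀ G H r (c : □V G H → Fin r) i {x} →
                 x ∈ colorsOfCopy G H r c i → ∃ λ a → c (a , i) ≡ x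
∈-colorsOfCopy G H r c i {x} x∈colours =
  invert (subst (Reflects _) (trans (sym (lookup∘tabulate _ x)) ([]=⇒lookup x∈colours))
                (proof (any? λ a → c (a , i) ≟ x)))

lemma3 : (G H : Graph) → Connected G → Connected H → 2 ≤ n G → 2 ≤ n H →
         (r : ℕ) → 3 ≤ r → (c : □V G H → Fin r) → ExactColoring G H r c →
         ¬ Rainbow3AP G H r c →
         ∀ (i : Fin (n H)) → ∣ colorsOfCopy G H r c i ∣ ≤ 2
lemma3 G H connected-G connected-H _ 2≤|H| r _ c _ rainbow-free i = ≮⇒≥ λ 2<|colours| →
  let x , y , z , (x∈ , y∈ , z∈) , xyz = three-members 2<|colours|
      a₁ , c₁≡x = ∈-colorsOfCopy G H r c i x∈
      a₂ , c₂≡y = ∈-colorsOfCopy G H r c i y∈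
      a₃ , c₃≡z = ∈-colorsOfCopy G H r c i z∈
  in RainbowFree.copy-not-tricolored G H connected-H 2≤|H| c rainbow-free connected-G i
       (Distinct₃-resp c₁≡x c₂≡y c₃≡z xyz)
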